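{- Let $n\ge 2$ and let $\tau_i=(c_i,d_i,p_i,J_i)$, $i=1,\dots,n$, be nonnegative integers with $c_i\ge1$, $p_i\ge1$, $c_i\le d_i\le p_i$, $J_i=0$ for all $i$, and $\sum_{i\le n}c_i/p_i\le 1$, $\sum_{i<n}c_i/p_i<1$. Let $r_n=\min\{t\in\mathbb{Z}_{\ge0}: t\ge c_n+\sum_{i<n}c_i\lceil t/p_i\rceil\}$ and $P=\mathrm{lcm}_{i\le n}p_i$. Then \[ \frac{c_n}{1-\sum_{i<n}\frac{c_i}{p_i}}\le r_n\le P. \]
   Context: $\mathrm{lcm}_{i\le n}p_i$ is the least common multiple of $p_1,\dots,p_n$. $r_n$ is the worst-case response time of the lowest-priority task in a jitter-free fixed-priority system. -}

module Defs where

open import Data.Nat as ℕ using (ℕ; zero; suc; _+_; _*_; _≤_; _<_)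
open import Data.Nat.DivMod using (_/_)
open import Data.Nat.LCM using (lcm)
open import Data.Fin using (Fin; inject₁; fromℕ)
import Data.Fin as F
open import Data.Integer using (+_)
open import Data.Rational as ℚ using (ℚ; 0ℚ; _÷_; _≟_; ≢-nonZero)
open import Relation.Nullary using (yes; no; ¬_)

-- ⌈ t / p ⌉ for p ≥ 1 (value at p = 0 is an irrelevant junk value 0)
ceilDiv : ℕ → ℕ → ℕ
ceilDiv t zero    = 0
ceilDiv t (suc k) = (t + k) / suc k

toℚ : ℕ → ℚ
toℚ n = (+ n) ℚ./ 1

ratio : ℕ → ℕ → ℚ
ratio c zero    = 0ℚ
ratio c (suc k) = (+ c) ℚ./ suc k

-- rational division x / y (junk value 0 when y = 0)
divℚ : ℚ → ℚ → ℚ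
divℚ x y with y ≟ 0ℚ
... | yes _ = 0ℚ
... | no y≢0 = _÷_ x y {{≢-nonZero y≢0}}

sumℕ : ∀ {n} → (Fin n → ℕ) → ℕ
sumℕ {zero}  f = 0
sumℕ {suc n} f = f F.zero + sumℕ (λ i → f (F.suc i))

sumℚ : ∀ {n} → (Fin n → ℚ) → ℚ
sumℚ {zero}  f = 0ℚ
sumℚ {suc n} f = f F.zero ℚ.+ sumℚ (λ i → f (F.suc i))

lcmAll : ∀ {n} → (Fin n → ℕ) → ℕ
lcmAll {zero}  f = 1
lcmAll {suc n} f = lcm (f F.zero) (lcmAll (λ i → f (F.suc i)))

-- Tasks are indexed by Fin (suc m) (so n = m + 1); the lowest-priority
-- task τ_n is  fromℕ m, the higher-priority tasks i < n are  inject₁ i, i : Fin m.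
-- t satisfies the response-time inequality  t ≥ c_n + Σ_{i<n} c_i ⌈t/p_i⌉
RTAIneq : (m : ℕ) → (c p : Fin (suc m) → ℕ) → ℕ → Set
RTAIneq m c p t =
  c (fromℕ m) + sumℕ (λ (i : Fin m) → c (inject₁ i) * ceilDiv t (p (inject₁ i))) ≤ t

IsMin : (ℕ → Set) → ℕ → Set
IsMin P r = P r × (∀ t → t < r → ¬ P t)
  where open import Data.Product using (_×_)

{-# OPTIONS --safe #-}
-- Since c ⌈t/p⌉ ≥ (c/p) t, the response-time inequality at r yields c_n + U r ≤ r, where U is
-- the utilisation of the higher-priority tasks; hence c_n / (1 - U) ≤ r.  At the hyperperiod
-- P every ⌈P/p_i⌉ is exactly P/p_i and c_n ≤ (c_n/p_n) P, so the right-hand side of the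
-- inequality at P is at most (total utilisation) P ≤ P, and minimality of r gives r ≤ P.
module Submission where

open import Defs
open import Data.Nat as ℕ using (ℕ; zero; suc; _+_; _*_; _≤_)
import Data.Nat.Properties as ℕP
open import Data.Nat.DivMod using (_/_; _%_; m≡m%n+[m/n]*n; m%n<n; +-distrib-/-∣ˡ; m*n/n≡m; m<n⇒m/n≡0)
open import Data.Nat.Divisibility using (_∣_; divides; ∣-trans)
open import Data.Nat.GCD using (gcd)
open import Data.Nat.LCM using (lcm; m∣lcm[m,n]; n∣lcm[m,n]; gcd*lcm)
open import Data.Integer as ℤ using (+_)
import Data.Integer.Properties as ℤP
open import Data.Rational as ℚ using (ℚ; 0ℚ; 1ℚ; toℚᵘ)
import Data.Rational.Properties as ℚP
open import Data.Rational.Unnormalised as ℚᵘ using (mkℚᵘ; *≡*; *≤*) renaming (_≃_ to _≃ᵘ_)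
import Data.Rational.Unnormalised.Properties as ℚᵘP
open import Data.Fin as F using (Fin; inject₁; fromℕ)
open import Data.Product using (_×_; _,_)
open import Data.Empty using (⊥-elim)
open import Function using (_∘_)
open import Relation.Nullary using (yes; no)
open import Relation.Binary.PropositionalEquality

toℚᵘ-toℚ : ∀ n → toℚᵘ (toℚ n) ≃ᵘ mkℚᵘ (+ n) 0
toℚᵘ-toℚ n = ℚP.toℚᵘ-fromℚᵘ (mkℚᵘ (+ n) 0)

toℚᵘ-ratio : ∀ c k → toℚᵘ (ratio c (suc k)) ≃ᵘ mkℚᵘ (+ c) k
toℚᵘ-ratio c k = ℚP.toℚᵘ-fromℚᵘ (mkℚᵘ (+ c) k)

toℚ-+ : ∀ m n → toℚ (m + n) ≡ toℚ m ℚ.+ toℚ n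
toℚ-+ m n = ℚP.toℚᵘ-injective (begin-equality
  toℚᵘ (toℚ (m + n))                   ≃⟨ toℚᵘ-toℚ (m + n) ⟩
  mkℚᵘ (+ (m + n)) 0                   ≃⟨ *≡* (cong (ℤ._* ℤ.1ℤ) pos-+) ⟩
  mkℚᵘ (+ m) 0 ℚᵘ.+ mkℚᵘ (+ n) 0       ≃⟨ ℚᵘP.+-cong (toℚᵘ-toℚ m) (toℚᵘ-toℚ n) ⟨
  toℚᵘ (toℚ m) ℚᵘ.+ toℚᵘ (toℚ n)       ≃⟨ ℚP.toℚᵘ-homo-+ (toℚ m) (toℚ n) ⟨
  toℚᵘ (toℚ m ℚ.+ toℚ n)               ∎)
  where
  open ℚᵘP.≤-Reasoning
  pos-+ : + (m + n) ≡ + m ℤ.* ℤ.1ℤ ℤ.+ + n ℤ.* ℤ.1ℤ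
  pos-+ = trans (ℤP.pos-+ m n) (sym (cong₂ ℤ._+_ (ℤP.*-identityʳ (+ m)) (ℤP.*-identityʳ (+ n))))

toℚ-* : ∀ m n → toℚ (m * n) ≡ toℚ m ℚ.* toℚ n
toℚ-* m n = ℚP.toℚᵘ-injective (begin-equality
  toℚᵘ (toℚ (m * n))                   ≃⟨ toℚᵘ-toℚ (m * n) ⟩
  mkℚᵘ (+ (m * n)) 0                   ≃⟨ *≡* (cong (ℤ._* ℤ.1ℤ) (ℤP.pos-* m n)) ⟩
  mkℚᵘ (+ m) 0 ℚᵘ.* mkℚᵘ (+ n) 0       ≃⟨ ℚᵘP.*-cong (toℚᵘ-toℚ m) (toℚᵘ-toℚ n) ⟨
  toℚᵘ (toℚ m) ℚᵘ.* toℚᵘ (toℚ n)       ≃⟨ ℚP.toℚᵘ-homo-* (toℚ m) (toℚ n) ⟨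
  toℚᵘ (toℚ m ℚ.* toℚ n)               ∎)
  where open ℚᵘP.≤-Reasoning

toℚ-mono-≤ : ∀ {m n} → m ≤ n → toℚ m ℚ.≤ toℚ n
toℚ-mono-≤ {m} {n} m≤n = ℚP.toℚᵘ-cancel-≤ (begin
  toℚᵘ (toℚ m)  ≃⟨ toℚᵘ-toℚ m ⟩
  mkℚᵘ (+ m) 0  ≤⟨ *≤* (ℤP.*-monoʳ-≤-nonNeg ℤ.1ℤ (ℤ.+≤+ m≤n)) ⟩
  mkℚᵘ (+ n) 0  ≃⟨ toℚᵘ-toℚ n ⟨
  toℚᵘ (toℚ n)  ∎)
  where open ℚᵘP.≤-Reasoning

toℚ-cancel-≤ : ∀ {m n} → toℚ m ℚ.≤ toℚ n → m ≤ n
toℚ-cancel-≤ {m} {n} m≤n with ℚᵘP.≤-respˡ-≃ (toℚᵘ-toℚ m) (ℚᵘP.≤-respʳ-≃ (toℚᵘ-toℚ n) (ℚP.toℚᵘ-mono-≤ m≤n))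
... | *≤* m*1≤n*1 = ℤ.drop‿+≤+ (subst₂ ℤ._≤_ (ℤP.*-identityʳ (+ m)) (ℤP.*-identityʳ (+ n)) m*1≤n*1)

ratio-nonNeg : ∀ c p → 0ℚ ℚ.≤ ratio c p
ratio-nonNeg c zero    = ℚP.≤-refl
ratio-nonNeg c (suc k) = ℚP.toℚᵘ-cancel-≤ (ℚᵘP.≤-respʳ-≃ (ℚᵘP.≃-sym (toℚᵘ-ratio c k))
  (*≤* (subst (ℤ._≤_ _) (sym (ℤP.*-identityʳ (+ c))) (ℤ.+≤+ ℕ.z≤n))))

ratio-*-denominator : ∀ c k → ratio c (suc k) ℚ.* toℚ (suc k) ≡ toℚ c
ratio-*-denominator c k = ℚP.toℚᵘ-injective (begin-equality
  toℚᵘ (ratio c (suc k) ℚ.* toℚ (suc k))          ≃⟨ ℚP.toℚᵘ-homo-* (ratio c (suc k)) (toℚ (suc k)) ⟩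
  toℚᵘ (ratio c (suc k)) ℚᵘ.* toℚᵘ (toℚ (suc k))  ≃⟨ ℚᵘP.*-cong (toℚᵘ-ratio c k) (toℚᵘ-toℚ (suc k)) ⟩
  mkℚᵘ (+ c) k ℚᵘ.* mkℚᵘ (+ suc k) 0              ≃⟨ *≡* cancel-den ⟩
  mkℚᵘ (+ c) 0                                    ≃⟨ toℚᵘ-toℚ c ⟨
  toℚᵘ (toℚ c)                                    ∎)
  where
  open ℚᵘP.≤-Reasoning
  cancel-den : + c ℤ.* + suc k ℤ.* ℤ.1ℤ ≡ + c ℤ.* + (suc k ℕ.* 1)
  cancel-den = trans (ℤP.*-identityʳ _) (cong (λ d → + c ℤ.* + d) (sym (ℕP.*-identityʳ (suc k))))

ratio-*-multiple : ∀ c k q → ratio c (suc k) ℚ.* toℚ (q * suc k) ≡ toℚ (c * q)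
ratio-*-multiple c k q = begin
  ratio c (suc k) ℚ.* toℚ (q * suc k)              ≡⟨ cong (ratio c (suc k) ℚ.*_) (toℚ-* q (suc k)) ⟩
  ratio c (suc k) ℚ.* (toℚ q ℚ.* toℚ (suc k))      ≡⟨ cong (ratio c (suc k) ℚ.*_) (ℚP.*-comm (toℚ q) (toℚ (suc k))) ⟩
  ratio c (suc k) ℚ.* (toℚ (suc k) ℚ.* toℚ q)      ≡⟨ ℚP.*-assoc (ratio c (suc k)) (toℚ (suc k)) (toℚ q) ⟨
  (ratio c (suc k) ℚ.* toℚ (suc k)) ℚ.* toℚ q      ≡⟨ cong (ℚ._* toℚ q) (ratio-*-denominator c k) ⟩
  toℚ c ℚ.* toℚ q                                  ≡⟨ toℚ-* c q ⟨
  toℚ (c * q)                                      ∎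
  where open ≡-Reasoning

t≤ceilDiv[t,p]*p : ∀ t k → t ≤ ceilDiv t (suc k) * suc k
t≤ceilDiv[t,p]*p t k = ℕP.+-cancelʳ-≤ k t (ceilDiv t (suc k) * suc k) (begin
  t + k                                        ≡⟨ m≡m%n+[m/n]*n (t + k) (suc k) ⟩
  (t + k) % suc k + (t + k) / suc k * suc k    ≤⟨ ℕP.+-monoˡ-≤ _ (ℕP.<⇒≤pred (m%n<n (t + k) (suc k))) ⟩
  k + ceilDiv t (suc k) * suc k                ≡⟨ ℕP.+-comm k _ ⟩
  ceilDiv t (suc k) * suc k + k                ∎)
  where open ℕP.≤-Reasoning

ceilDiv-multiple : ∀ q k → ceilDiv (q * suc k) (suc k) ≡ q
ceilDiv-multiple q k = begin
  (q * suc k + k) / suc k          ≡⟨ +-distrib-/-∣ˡ k (divides q refl) ⟩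
  q * suc k / suc k + k / suc k    ≡⟨ cong₂ _+_ (m*n/n≡m q (suc k)) (m<n⇒m/n≡0 (ℕP.n<1+n k)) ⟩
  q + 0                            ≡⟨ ℕP.+-identityʳ q ⟩
  q                                ∎
  where open ≡-Reasoning

lcm-pos : ∀ {m n} → 1 ≤ m → 1 ≤ n → 1 ≤ lcm m n
lcm-pos {m} {n} 1≤m 1≤n = ℕ.>-nonZero⁻¹ (lcm m n) {{ℕP.m*n≢0⇒n≢0 (gcd m n) {{gcd*lcm≢0}}}}
  where
  gcd*lcm≢0 : ℕ.NonZero (gcd m n * lcm m n)
  gcd*lcm≢0 = subst ℕ.NonZero (sym (gcd*lcm m n)) (ℕP.m*n≢0 m n {{ℕ.>-nonZero 1≤m}} {{ℕ.>-nonZero 1≤n}})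

lcmAll-pos : ∀ {n} (f : Fin n → ℕ) → (∀ i → 1 ≤ f i) → 1 ≤ lcmAll f
lcmAll-pos {zero}  f 1≤f = ℕP.≤-refl
lcmAll-pos {suc n} f 1≤f = lcm-pos (1≤f F.zero) (lcmAll-pos (f ∘ F.suc) (1≤f ∘ F.suc))

∣lcmAll : ∀ {n} (f : Fin n → ℕ) i → f i ∣ lcmAll f
∣lcmAll {suc n} f F.zero    = m∣lcm[m,n] (f F.zero) (lcmAll (f ∘ F.suc))
∣lcmAll {suc n} f (F.suc i) = ∣-trans (∣lcmAll (f ∘ F.suc) i) (n∣lcm[m,n] (f F.zero) (lcmAll (f ∘ F.suc)))

toℚ-sumℕ : ∀ {n} (f : Fin n → ℕ) → toℚ (sumℕ f) ≡ sumℚ (toℚ ∘ f)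
toℚ-sumℕ {zero}  f = refl
toℚ-sumℕ {suc n} f = trans (toℚ-+ (f F.zero) (sumℕ (f ∘ F.suc))) (cong (toℚ (f F.zero) ℚ.+_) (toℚ-sumℕ (f ∘ F.suc)))

sumℚ-mono-≤ : ∀ {n} {f g : Fin n → ℚ} → (∀ i → f i ℚ.≤ g i) → sumℚ f ℚ.≤ sumℚ g
sumℚ-mono-≤ {zero}  f≤g = ℚP.≤-refl
sumℚ-mono-≤ {suc n} f≤g = ℚP.+-mono-≤ (f≤g F.zero) (sumℚ-mono-≤ (f≤g ∘ F.suc))

sumℚ-*ʳ : ∀ {n} (f : Fin n → ℚ) x → sumℚ (λ i → f i ℚ.* x) ≡ sumℚ f ℚ.* x
sumℚ-*ʳ {zero}  f x = sym (ℚP.*-zeroˡ x)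
sumℚ-*ʳ {suc n} f x = trans (cong (f F.zero ℚ.* x ℚ.+_) (sumℚ-*ʳ (f ∘ F.suc) x)) (sym (ℚP.*-distribʳ-+ x (f F.zero) _))

sumℚ-last : ∀ m (f : Fin (suc m) → ℚ) → sumℚ f ≡ f (fromℕ m) ℚ.+ sumℚ (f ∘ inject₁)
sumℚ-last zero    f = refl
sumℚ-last (suc m) f = begin
  f F.zero ℚ.+ sumℚ (f ∘ F.suc)     ≡⟨ cong (f F.zero ℚ.+_) (sumℚ-last m (f ∘ F.suc)) ⟩
  f F.zero ℚ.+ (last ℚ.+ rest)      ≡⟨ ℚP.+-assoc (f F.zero) last rest ⟨
  (f F.zero ℚ.+ last) ℚ.+ rest      ≡⟨ cong (ℚ._+ rest) (ℚP.+-comm (f F.zero) last) ⟩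
  (last ℚ.+ f F.zero) ℚ.+ rest      ≡⟨ ℚP.+-assoc last (f F.zero) rest ⟩
  last ℚ.+ (f F.zero ℚ.+ rest)      ∎
  where
  open ≡-Reasoning
  last rest : ℚ
  last = f (fromℕ (suc m))
  rest = sumℚ (f ∘ F.suc ∘ inject₁)

utilisation : ∀ {n} → (Fin n → ℕ) → (Fin n → ℕ) → ℚ
utilisation c p = sumℚ (λ i → ratio (c i) (p i))

ratio-*-≤-demand : ∀ c p t → 1 ≤ p → ratio c p ℚ.* toℚ t ℚ.≤ toℚ (c * ceilDiv t p)
ratio-*-≤-demand c (suc k) t _ = begin
  ratio c (suc k) ℚ.* toℚ t                             ≤⟨ ℚP.*-monoˡ-≤-nonNeg (ratio c (suc k)) {{ℚ.nonNegative (ratio-nonNeg c (suc k))}}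
                                                             (toℚ-mono-≤ (t≤ceilDiv[t,p]*p t k)) ⟩
  ratio c (suc k) ℚ.* toℚ (ceilDiv t (suc k) * suc k)   ≡⟨ ratio-*-multiple c k (ceilDiv t (suc k)) ⟩
  toℚ (c * ceilDiv t (suc k))                           ∎
  where open ℚP.≤-Reasoning

demand-at-multiple : ∀ c p P → 1 ≤ p → p ∣ P → toℚ (c * ceilDiv P p) ≡ ratio c p ℚ.* toℚ P
demand-at-multiple c (suc k) _ _ (divides q refl) = begin
  toℚ (c * ceilDiv (q * suc k) (suc k))   ≡⟨ cong (toℚ ∘ (c *_)) (ceilDiv-multiple q k) ⟩
  toℚ (c * q)                             ≡⟨ ratio-*-multiple c k q ⟨
  ratio c (suc k) ℚ.* toℚ (q * suc k)     ∎
  where open ≡-Reasoning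

toℚ-≤-ratio-*-multiple : ∀ c p P → 1 ≤ p → 1 ≤ P → p ∣ P → toℚ c ℚ.≤ ratio c p ℚ.* toℚ P
toℚ-≤-ratio-*-multiple c (suc k) _ _ 1≤P (divides q refl) = begin
  toℚ c                                   ≤⟨ toℚ-mono-≤ (ℕP.m≤m*n c q {{ℕP.m*n≢0⇒m≢0 q {{ℕ.>-nonZero 1≤P}}}}) ⟩
  toℚ (c * q)                             ≡⟨ ratio-*-multiple c k q ⟨
  ratio c (suc k) ℚ.* toℚ (q * suc k)     ∎
  where open ℚP.≤-Reasoning

p<q⇒0<q-p : ∀ {p q} → p ℚ.< q → 0ℚ ℚ.< q ℚ.- p
p<q⇒0<q-p {p} {q} p<q = subst (ℚ._< q ℚ.- p) (ℚP.+-inverseʳ p) (ℚP.+-monoˡ-< (ℚ.- p) p<q)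

c+u*r≤r⇒c≤[1-u]*r : ∀ c u r → c ℚ.+ u ℚ.* r ℚ.≤ r → c ℚ.≤ (1ℚ ℚ.- u) ℚ.* r
c+u*r≤r⇒c≤[1-u]*r c u r c+ur≤r = subst₂ ℚ._≤_ cancel factor (ℚP.+-monoˡ-≤ (ℚ.- (u ℚ.* r)) c+ur≤r)
  where
  cancel : c ℚ.+ u ℚ.* r ℚ.- u ℚ.* r ≡ c
  cancel = trans (ℚP.+-assoc c _ _) (trans (cong (c ℚ.+_) (ℚP.+-inverseʳ (u ℚ.* r))) (ℚP.+-identityʳ c))
  factor : r ℚ.- u ℚ.* r ≡ (1ℚ ℚ.- u) ℚ.* r
  factor = sym (trans (ℚP.*-distribʳ-+ r 1ℚ (ℚ.- u)) (cong₂ ℚ._+_ (ℚP.*-identityˡ r) (sym (ℚP.neg-distribˡ-* u r))))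

divℚ-≤ : ∀ x y z → 0ℚ ℚ.< y → x ℚ.≤ y ℚ.* z → divℚ x y ℚ.≤ z
divℚ-≤ x y z 0<y x≤yz with y ℚ.≟ 0ℚ
... | yes y≡0 = ⊥-elim (ℚP.<-irrefl (sym y≡0) 0<y)
... | no y≢0 = ℚP.*-cancelʳ-≤-pos y {{ℚ.positive 0<y}} (subst₂ ℚ._≤_ x≡[x÷y]*y (ℚP.*-comm y z) x≤yz)
  where
  instance
    y-nonZero : ℚ.NonZero y
    y-nonZero = ℚ.≢-nonZero y≢0
  x≡[x÷y]*y : x ≡ (x ℚ.÷ y) ℚ.* y
  x≡[x÷y]*y = sym (trans (ℚP.*-assoc x (ℚ.1/ y) y) (trans (cong (x ℚ.*_) (ℚP.*-inverseˡ y)) (ℚP.*-identityʳ x)))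

IsMin⇒≤ : ∀ {P : ℕ → Set} {r t} → IsMin P r → P t → r ≤ t
IsMin⇒≤ {t = t} (_ , below-r) Pt = ℕP.≮⇒≥ (λ t<r → below-r t t<r Pt)

module _ (m : ℕ) (c p : Fin (suc m) → ℕ) (1≤p : ∀ i → 1 ≤ p i) where

  private
    cₙ : ℕ
    cₙ = c (fromℕ m)

    demand : ℕ → Fin m → ℕ
    demand t i = c (inject₁ i) * ceilDiv t (p (inject₁ i))

  RTAIneq⇒c+U*t≤t : ∀ {t} → RTAIneq m c p t →
    toℚ cₙ ℚ.+ utilisation (c ∘ inject₁) (p ∘ inject₁) ℚ.* toℚ t ℚ.≤ toℚ t
  RTAIneq⇒c+U*t≤t {t} rta = begin
    toℚ cₙ ℚ.+ sumℚ u ℚ.* toℚ t                 ≡⟨ cong (toℚ cₙ ℚ.+_) (sumℚ-*ʳ u (toℚ t)) ⟨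
    toℚ cₙ ℚ.+ sumℚ (λ i → u i ℚ.* toℚ t)       ≤⟨ ℚP.+-monoʳ-≤ (toℚ cₙ) (sumℚ-mono-≤ λ i →
                                                    ratio-*-≤-demand (c (inject₁ i)) (p (inject₁ i)) t (1≤p (inject₁ i))) ⟩
    toℚ cₙ ℚ.+ sumℚ (toℚ ∘ demand t)            ≡⟨ cong (toℚ cₙ ℚ.+_) (toℚ-sumℕ (demand t)) ⟨
    toℚ cₙ ℚ.+ toℚ (sumℕ (demand t))            ≡⟨ toℚ-+ cₙ (sumℕ (demand t)) ⟨
    toℚ (cₙ + sumℕ (demand t))                  ≤⟨ toℚ-mono-≤ rta ⟩
    toℚ t                                       ∎
    where
    open ℚP.≤-Reasoning
    u : Fin m → ℚ
    u i = ratio (c (inject₁ i)) (p (inject₁ i))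

  RTAIneq-lcmAll : utilisation c p ℚ.≤ 1ℚ → RTAIneq m c p (lcmAll p)
  RTAIneq-lcmAll U≤1 = toℚ-cancel-≤ (begin
    toℚ (cₙ + sumℕ (demand P))                  ≡⟨ toℚ-+ cₙ (sumℕ (demand P)) ⟩
    toℚ cₙ ℚ.+ toℚ (sumℕ (demand P))            ≡⟨ cong (toℚ cₙ ℚ.+_) (toℚ-sumℕ (demand P)) ⟩
    toℚ cₙ ℚ.+ sumℚ (toℚ ∘ demand P)            ≤⟨ ℚP.+-mono-≤ (toℚ-≤-ratio-*-multiple cₙ (p (fromℕ m)) P (1≤p (fromℕ m)) 1≤P (∣lcmAll p (fromℕ m)))
                                                     (sumℚ-mono-≤ λ i → ℚP.≤-reflexive
                                                       (demand-at-multiple (c (inject₁ i)) (p (inject₁ i)) P (1≤p (inject₁ i)) (∣lcmAll p (inject₁ i)))) ⟩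
    uP (fromℕ m) ℚ.+ sumℚ (uP ∘ inject₁)        ≡⟨ sumℚ-last m uP ⟨
    sumℚ uP                                     ≡⟨ sumℚ-*ʳ (λ i → ratio (c i) (p i)) (toℚ P) ⟩
    utilisation c p ℚ.* toℚ P                   ≤⟨ ℚP.*-monoʳ-≤-nonNeg (toℚ P) {{ℚ.nonNegative (toℚ-mono-≤ {0} {P} ℕ.z≤n)}} U≤1 ⟩
    1ℚ ℚ.* toℚ P                                ≡⟨ ℚP.*-identityˡ (toℚ P) ⟩
    toℚ P                                       ∎)
    where
    open ℚP.≤-Reasoning
    P : ℕ
    P = lcmAll p
    1≤P : 1 ≤ P
    1≤P = lcmAll-pos p 1≤p
    uP : Fin (suc m) → ℚ
    uP i = ratio (c i) (p i) ℚ.* toℚ P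

lemma8 : (m : ℕ) → 1 ≤ m →
    (c d p J : Fin (suc m) → ℕ) →
    (∀ i → 1 ≤ c i) → (∀ i → 1 ≤ p i) →
    (∀ i → c i ≤ d i) → (∀ i → d i ≤ p i) → (∀ i → J i ≡ 0) →
    sumℚ (λ i → ratio (c i) (p i)) ℚ.≤ ℚ.1ℚ →
    sumℚ (λ (i : Fin m) → ratio (c (inject₁ i)) (p (inject₁ i))) ℚ.< ℚ.1ℚ →
    (r : ℕ) → IsMin (RTAIneq m c p) r →
    (divℚ (toℚ (c (fromℕ m)))
          (ℚ.1ℚ ℚ.- sumℚ (λ (i : Fin m) → ratio (c (inject₁ i)) (p (inject₁ i))))
       ℚ.≤ toℚ r)
    × (r ≤ lcmAll p)
lemma8 m _ c _ p _ _ 1≤p _ _ _ U≤1 Uhp<1 r r-min@(rta , _) = lower-bound , upper-bound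
  where
  Uhp : ℚ
  Uhp = utilisation (c ∘ inject₁) (p ∘ inject₁)

  lower-bound : divℚ (toℚ (c (fromℕ m))) (1ℚ ℚ.- Uhp) ℚ.≤ toℚ r
  lower-bound = divℚ-≤ _ _ _ (p<q⇒0<q-p Uhp<1)
    (c+u*r≤r⇒c≤[1-u]*r (toℚ (c (fromℕ m))) Uhp (toℚ r) (RTAIneq⇒c+U*t≤t m c p 1≤p rta))

  upper-bound : r ≤ lcmAll p
  upper-bound = IsMin⇒≤ r-min (RTAIneq-lcmAll m c p 1≤p U≤1)
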